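{- For all regular trees $\mathfrak A,\mathfrak B\in\mathfrak T$: $\mathfrak A\simeq_{\mathfrak T}\mathfrak B$ if and only if $\mathsf N(\mathfrak A)\simeq_\emptyset\mathsf N(\mathfrak B)$.
   Context: $\mathfrak T$ is the set of regular, possibly infinite, trees over nullary symbols $a$ (type variables and constants) and binary symbols $@,\supset,\oplus$, with no infinite branch consisting only of $\oplus$ nodes. A maximal union $\bigoplus_{i\in1..n}\mathfrak A_i$ is a tree whose top part consists of $\oplus$ nodes with frontier subtrees $\mathfrak A_1,\dots,\mathfrak A_n$ (left to right), none $\oplus$-rooted ($\mathfrak A_1$ if $n=1$); "$\mathfrak A\neq\oplus$" means the root is not $\oplus$. $\simeq_{\mathfrak T}$ is the greatest relation $\mathcal S$ on $\mathfrak T$ such that every pair in $\mathcal S$ is the conclusion of one of these rules with premises in $\mathcal S$: $a\simeq a$; $\mathfrak D\mathbin{@}\mathfrak A\simeq\mathfrak D'\mathbin{@}\mathfrak A'$ if $\mathfrak D\simeq\mathfrak D'$, $\mathfrak A\simeq\mathfrak A'$; $\mathfrak A\supset\mathfrak B\simeq\mathfrak A'\supset\mathfrak B'$ if $\mathfrak A\simeq\mathfrak A'$, $\mathfrak B\simeq\mathfrak B'$; $\bigoplus_{i\in1..n}\mathfrak A_i\simeq\bigoplus_{j\in1..m}\mathfrak B_j$ with all components $\neq\oplus$ and $n+m>2$, if there are $f:1..n\to1..m$, $g:1..m\to1..n$ with $\mathfrak A_i\simeq\mathfrak B_{f(i)}$ and $\mathfrak A_{g(j)}\simeq\mathfrak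 B_j$ for all $i,j$. $\mathfrak T^n$: possibly infinite trees over $a$ (arity 0), $@,\supset$ (arity 2), $\oplus^n$ (arity $n>1$). $\mathsf N:\mathfrak T\to\mathfrak T^n$: $\mathsf N(a)=a$; $\mathsf N(\mathfrak A_1\star\mathfrak A_2)=\star(\mathsf N(\mathfrak A_1),\mathsf N(\mathfrak A_2))$ for $\star\in\{@,\supset\}$; $\mathsf N(\bigoplus_{i\in1..n}\mathfrak A_i)=\oplus^n(\mathsf N(\mathfrak A_1),\dots,\mathsf N(\mathfrak A_n))$ for maximal unions with $n>1$. $\simeq_\emptyset$ is the greatest relation $\mathcal S$ on $\mathfrak T^n$ such that every pair in $\mathcal S$ is the conclusion of one of these rules with premises in $\mathcal S$: $a\simeq a$; $\mathfrak D\mathbin{@}\mathfrak A\simeq\mathfrak D'\mathbin{@}\mathfrak A'$ if $\mathfrak D\simeq\mathfrak D'$, $\mathfrak A\simeq\mathfrak A'$; $\mathfrak A\supset\mathfrak B\simeq\mathfrak A'\supset\mathfrak B'$ if $\mathfrak A'\simeq\mathfrak A$, $\mathfrak B\simeq\mathfrak B'$; $\oplus^n(\mathfrak A_i)_i\simeq\oplus^m(\mathfrak B_j)_j$ (components $\neq\oplus$) if some $f:1..n\to1..m$, $g:1..m\to1..n$ satisfy $\mathfrak A_i\simeq\mathfrak B_{f(i)}$, $\mathfrak A_{g(j)}\simeq\mathfrak B_j$; $\oplus^n(\mathfrak A_i)_i\simeq\mathfrak B$ with $\mathfrak B,\mathfrak A_i\neq\oplus$ if $\mathfrak A_i\simeq\mathfrak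 B$ for all $i$; $\mathfrak A\simeq\oplus^m(\mathfrak B_j)_j$ with $\mathfrak A,\mathfrak B_j\neq\oplus$ if $\mathfrak A\simeq\mathfrak B_j$ for all $j$. -}

module Defs where

open import Data.Nat using (ℕ; zero; suc; _<_; _≤_; _∸_)
open import Data.Fin using (Fin; toℕ)
open import Data.List using (List; []; _∷_; _++_; length; lookup)
open import Data.List.Properties using (++-assoc)
open import Data.Maybe using (Maybe; just; nothing)
open import Data.Product using (Σ; ∃; _×_; _,_)
open import Relation.Nullary using (¬_)
open import Relation.Binary.PropositionalEquality using (_≡_; refl; cong; sym; trans; subst)

-- Generic (possibly infinite) labelled trees, as partial maps from
-- positions (lists of child indices, root = []) to labels.

Pos : Set
Pos = List ℕ

Tree : Set → Set
Tree L = Pos → Maybe L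

sub : ∀ {L} → Tree L → Pos → Tree L
sub t p q = t (p ++ q)

child : ∀ {L} → Tree L → ℕ → Tree L
child t i q = t (i ∷ q)

record IsTree {L : Set} (ar : L → ℕ) (t : Tree L) : Set where
  field
    root-def    : ∃ λ l → t [] ≡ just l
    child-def   : ∀ p l → t p ≡ just l → ∀ i → i < ar l →
                  ∃ λ l′ → t (p ++ i ∷ []) ≡ just l′
    child-undef : ∀ p l → t p ≡ just l → ∀ i → ar l ≤ i →
                  ∀ q → t (p ++ i ∷ q) ≡ nothing

Regular : ∀ {L} → Tree L → Set
Regular {L} t = Σ ℕ λ n → Σ (Fin n → Tree L) λ reps →
  ∀ p → Σ (Fin n) λ i → ∀ q → t (p ++ q) ≡ reps i q

-- The trees of 𝔗: nullary a (names ℕ), binary @ (app), ⊃ (arr), ⊕ (uni)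

data LabT : Set where
  atom : ℕ → LabT
  app arr uni : LabT

arT : LabT → ℕ
arT (atom _) = 0
arT app = 2
arT arr = 2
arT uni = 2

TreeT : Set
TreeT = Tree LabT

-- the ⊕-top part of t is well-founded (no infinite branch of ⊕ nodes
-- starting at the root)
data UFin (t : TreeT) : Set where
  leaf : ¬ (t [] ≡ just uni) → UFin t
  node : t [] ≡ just uni → UFin (child t 0) → UFin (child t 1) → UFin t

record In𝔗 (t : TreeT) : Set where
  field
    isTree  : IsTree arT t
    regular : Regular t
    noInf⊕  : ∀ p → UFin (sub t p)
open In𝔗 public

-- maximal union decomposition  t = ⊕_{i} As_i  (left to right)
data MaxUnion (t : TreeT) : List TreeT → Set where
  single : ¬ (t [] ≡ just uni) → MaxUnion t (t ∷ [])
  split  : ∀ {As Bs} → t [] ≡ just uni → MaxUnion (child t 0) As →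
           MaxUnion (child t 1) Bs → MaxUnion t (As ++ Bs)

data StepT (S : TreeT → TreeT → Set) (A B : TreeT) : Set where
  atom  : ∀ a → A [] ≡ just (atom a) → B [] ≡ just (atom a) → StepT S A B
  app   : A [] ≡ just app → B [] ≡ just app →
          S (child A 0) (child B 0) → S (child A 1) (child B 1) → StepT S A B
  arr   : A [] ≡ just arr → B [] ≡ just arr →
          S (child A 0) (child B 0) → S (child A 1) (child B 1) → StepT S A B
  union : ∀ As Bs → MaxUnion A As → MaxUnion B Bs →
          2 < length As Data.Nat.+ length Bs →
          (f : Fin (length As) → Fin (length Bs)) →
          (g : Fin (length Bs) → Fin (length As)) →
          (∀ i → S (lookup As i) (lookup Bs (f i))) →
          (∀ j → S (lookup As (g j)) (lookup Bs j)) → StepT S A B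

IsSimT : (TreeT → TreeT → Set) → Set
IsSimT S = ∀ A B → S A B → In𝔗 A × In𝔗 B × StepT S A B

_≃𝔗_ : TreeT → TreeT → Set₁
A ≃𝔗 B = Σ (TreeT → TreeT → Set) λ S → IsSimT S × S A B

-- The trees of 𝔗ⁿ: a, @, ⊃, and ⊕ⁿ for n > 1 (uni k stands for ⊕^(2+k))

data LabN : Set where
  atom : ℕ → LabN
  app arr : LabN
  uni : ℕ → LabN

arN : LabN → ℕ
arN (atom _) = 0
arN app = 2
arN arr = 2
arN (uni k) = suc (suc k)

TreeN : Set
TreeN = Tree LabN

In𝔗ⁿ : TreeN → Set
In𝔗ⁿ = IsTree arN

NotU : TreeN → Set
NotU t = ∀ k → ¬ (t [] ≡ just (uni k))

chF : ∀ {n} → TreeN → Fin n → TreeN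
chF t i = child t (toℕ i)

data StepN (S : TreeN → TreeN → Set) (X Y : TreeN) : Set where
  atom : ∀ a → X [] ≡ just (atom a) → Y [] ≡ just (atom a) → StepN S X Y
  app  : X [] ≡ just app → Y [] ≡ just app →
         S (child X 0) (child Y 0) → S (child X 1) (child Y 1) → StepN S X Y
  arr  : X [] ≡ just arr → Y [] ≡ just arr →
         S (child Y 0) (child X 0) → S (child X 1) (child Y 1) → StepN S X Y
  uu   : ∀ k l → X [] ≡ just (uni k) → Y [] ≡ just (uni l) →
         (∀ (i : Fin (suc (suc k))) → NotU (chF X i)) →
         (∀ (j : Fin (suc (suc l))) → NotU (chF Y j)) →
         (f : Fin (suc (suc k)) → Fin (suc (suc l))) →
         (g : Fin (suc (suc l)) → Fin (suc (suc k))) →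
         (∀ i → S (chF X i) (chF Y (f i))) →
         (∀ j → S (chF X (g j)) (chF Y j)) → StepN S X Y
  ul   : ∀ k → X [] ≡ just (uni k) → NotU Y →
         (∀ (i : Fin (suc (suc k))) → NotU (chF X i)) →
         (∀ (i : Fin (suc (suc k))) → S (chF X i) Y) → StepN S X Y
  ur   : ∀ l → Y [] ≡ just (uni l) → NotU X →
         (∀ (j : Fin (suc (suc l))) → NotU (chF Y j)) →
         (∀ (j : Fin (suc (suc l))) → S X (chF Y j)) → StepN S X Y

IsSimN : (TreeN → TreeN → Set) → Set
IsSimN S = ∀ X Y → S X Y → In𝔗ⁿ X × In𝔗ⁿ Y × StepN S X Y

_≃∅_ : TreeN → TreeN → Set₁
X ≃∅ Y = Σ (TreeN → TreeN → Set) λ S → IsSimN S × S X Y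

-- positions (relative to t) of the frontier of the ⊕-top part, left to right
frontier : ∀ {t} → UFin t → List Pos
frontier (leaf _) = [] ∷ []
frontier (node _ u₀ u₁) =
  Data.List.map (0 ∷_) (frontier u₀) ++ Data.List.map (1 ∷_) (frontier u₁)

UFin-resp : ∀ {t u} → (∀ q → t q ≡ u q) → UFin t → UFin u
UFin-resp e (leaf n) = leaf (λ h → n (trans (e []) h))
UFin-resp e (node h u₀ u₁) =
  node (trans (sym (e [])) h) (UFin-resp (λ q → e (0 ∷ q)) u₀)
       (UFin-resp (λ q → e (1 ∷ q)) u₁)

nth : ∀ {A : Set} → List A → ℕ → Maybe A
nth [] _ = nothing
nth (x ∷ xs) zero = just x
nth (x ∷ xs) (suc i) = nth xs i

N : (t : TreeT) → (∀ p → UFin (sub t p)) → TreeN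
N t w [] with t []
... | nothing = nothing
... | just (atom a) = just (atom a)
... | just app = just app
... | just arr = just arr
... | just uni = just (uni (length (frontier (w [])) ∸ 2))
N t w (i ∷ q) with t []
... | nothing = nothing
... | just (atom a) = nothing
... | just app = N (child t i) (λ p → w (i ∷ p)) q
... | just arr = N (child t i) (λ p → w (i ∷ p)) q
... | just uni with nth (frontier (w [])) i
...   | nothing = nothing
...   | just r = N (sub t r)
          (λ p → UFin-resp (λ q′ → cong t (++-assoc r p q′)) (w (r ++ p))) q

N𝔗 : (t : TreeT) → In𝔗 t → TreeN
N𝔗 t h = N t (noInf⊕ h)

module Submission where

-- Both equivalences are greatest fixed points, so each direction is proved
-- by exhibiting a simulation.  Since the ⊃-rule of ≃∅ is contravariant in
-- its first premise while that of ≃𝔗 is covariant, we first pass to the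
-- symmetric closure of the given simulation, which is again a simulation.
-- Then:
--   * a symmetric 𝔗-simulation S is carried to the relation "Image S"
--     between translations of S-related trees, which is a ∅-simulation;
--   * a symmetric ∅-simulation R is carried to the relation "Preimage R"
--     between 𝔗-trees whose translations are R-related, a 𝔗-simulation.
-- The core of both is a dictionary between the two kinds of trees: N
-- preserves root labels and binary children, and translates a maximal
-- union ⊕(A₁,…,Aₙ) (n ≥ 2) into ⊕ⁿ(N A₁,…,N Aₙ) ("union translation").

open import Defs
open import Data.Nat using (ℕ; zero; suc; _<_; _≤_; _∸_; _+_; z≤n; s≤s)
open import Data.Nat.Properties
  using (+-mono-≤; +-mono-≤-<; +-comm; <-≤-connex; ≤-trans; m+[n∸m]≡n)
open import Data.Fin using (Fin; toℕ; cast) renaming (zero to fzero; suc to fsuc)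
open import Data.Fin.Properties using (toℕ-cast; cast-involutive)
open import Data.List using (List; []; _∷_; _++_; length; map; lookup)
open import Data.List.Properties using (++-assoc; map-++; length-map; length-++)
open import Data.List.Membership.Propositional.Properties using (∈-lookup)
open import Data.List.Relation.Unary.All as All using (All; []; _∷_)
open import Data.List.Relation.Unary.All.Properties using (++⁺; map⁺)
open import Data.Maybe using (Maybe; just; nothing)
open import Data.Maybe.Properties using (just-injective)
open import Data.Product using (Σ; ∃; _×_; _,_; proj₁; proj₂)
open import Data.Sum using (_⊎_; inj₁; inj₂)
open import Data.Empty using (⊥-elim)
open import Function.Bundles using (_⇔_; mk⇔)
open import Relation.Nullary using (¬_)
open import Relation.Binary.Definitions using (Symmetric)
open import Relation.Binary.Construct.Closure.Symmetric
  using (SymClosure; fwd; bwd; symmetric)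
open import Relation.Binary.PropositionalEquality

open IsTree using (root-def; child-def; child-undef)

nothing≢just : ∀ {A : Set} {x : A} → nothing ≢ just x
nothing≢just ()

nth-< : ∀ {A : Set} (xs : List A) i → i < length xs → ∃ λ x → nth xs i ≡ just x
nth-< (x ∷ xs) zero    _          = x , refl
nth-< (x ∷ xs) (suc i) (s≤s i<n) = nth-< xs i i<n

nth-≥ : ∀ {A : Set} (xs : List A) i → length xs ≤ i → nth xs i ≡ nothing
nth-≥ []       i       _          = refl
nth-≥ (x ∷ xs) (suc i) (s≤s n≤i) = nth-≥ xs i n≤i

nth-All : ∀ {A : Set} {P : A → Set} {xs i x} → All P xs → nth xs i ≡ just x → P x
nth-All {i = zero}  (px ∷ _)   refl = px
nth-All {i = suc i} (_  ∷ pxs) e    = nth-All {i = i} pxs e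

nth-map-lookup : ∀ {A B : Set} (f : A → B) (xs : List A) (a : Fin (length (map f xs))) →
  ∃ λ x → nth xs (toℕ a) ≡ just x × lookup (map f xs) a ≡ f x
nth-map-lookup f (x ∷ xs) fzero    = x , refl , refl
nth-map-lookup f (x ∷ xs) (fsuc a) = nth-map-lookup f xs a

-- Pointwise equality of trees.  Without function extensionality this is
-- the equality up to which translations are compared.
_≐_ : ∀ {L : Set} → Tree L → Tree L → Set
X ≐ Y = ∀ q → X q ≡ Y q

IsTree-resp : ∀ {L} {ar : L → ℕ} {X Y : Tree L} → X ≐ Y → IsTree ar Y → IsTree ar X
IsTree-resp e T = record
  { root-def    = let (l , h) = root-def T in l , trans (e []) h
  ; child-def   = λ p l h i i<ar →
      let (l′ , h′) = child-def T p l (trans (sym (e p)) h) i i<ar in l′ , trans (e _) h′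
  ; child-undef = λ p l h i ar≤i q →
      trans (e _) (child-undef T p l (trans (sym (e p)) h) i ar≤i q) }

IsTree-sub : ∀ {L} {ar : L → ℕ} {t : Tree L} → IsTree ar t →
  ∀ r → (∃ λ l → t (r ++ []) ≡ just l) → IsTree ar (sub t r)
IsTree-sub {t = t} T r d = record
  { root-def    = d
  ; child-def   = λ p l h i i<ar →
      let (l′ , h′) = child-def T (r ++ p) l h i i<ar
      in l′ , trans (cong t (sym (++-assoc r p (i ∷ [])))) h′
  ; child-undef = λ p l h i ar≤i q →
      trans (cong t (sym (++-assoc r p (i ∷ q)))) (child-undef T (r ++ p) l h i ar≤i q) }

IsTree-child : ∀ {L} {ar : L → ℕ} {t : Tree L} {l i} → IsTree ar t →
  t [] ≡ just l → i < ar l → IsTree ar (child t i)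
IsTree-child {i = i} T h i<ar = IsTree-sub T (i ∷ []) (child-def T [] _ h i i<ar)

Fin⊕ : TreeT → Set
Fin⊕ t = ∀ p → UFin (sub t p)

child-Fin⊕ : ∀ t → Fin⊕ t → ∀ i → Fin⊕ (child t i)
child-Fin⊕ t w i p = w (i ∷ p)

sub-Fin⊕ : ∀ t → Fin⊕ t → ∀ r → Fin⊕ (sub t r)
sub-Fin⊕ t w r p = UFin-resp (λ q → cong t (++-assoc r p q)) (w (r ++ p))

In𝔗-sub : ∀ {t} → In𝔗 t → ∀ r → (∃ λ l → t (r ++ []) ≡ just l) → In𝔗 (sub t r)
In𝔗-sub {t} ht r d = record
  { isTree  = IsTree-sub (isTree ht) r d
  ; regular = let (n , reps , rep) = regular ht in n , reps , λ p →
      let (i , e) = rep (r ++ p) in i , λ q → trans (cong t (sym (++-assoc r p q))) (e q)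
  ; noInf⊕  = sub-Fin⊕ t (noInf⊕ ht) r }

In𝔗-child : ∀ {t l i} → In𝔗 t → t [] ≡ just l → i < arT l → In𝔗 (child t i)
In𝔗-child {i = i} ht h i<ar = In𝔗-sub ht (i ∷ []) (child-def (isTree ht) [] _ h i i<ar)

data Binary : LabT → Set where
  app : Binary app
  arr : Binary arr

In𝔗-binary-child : ∀ {t l i} → Binary l → In𝔗 t → t [] ≡ just l → i < 2 → In𝔗 (child t i)
In𝔗-binary-child app = In𝔗-child
In𝔗-binary-child arr = In𝔗-child

isUni : (x : Maybe LabT) → x ≡ just uni ⊎ ¬ (x ≡ just uni)
isUni nothing         = inj₂ λ ()
isUni (just (atom _)) = inj₂ λ ()
isUni (just app)      = inj₂ λ ()
isUni (just arr)      = inj₂ λ ()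
isUni (just uni)      = inj₁ refl

components : ∀ {t} → UFin t → List TreeT
components {t} u = map (sub t) (frontier u)

length-frontier-node : ∀ {t} (h : t [] ≡ just uni) (u₀ : UFin (child t 0)) (u₁ : UFin (child t 1)) →
  length (frontier {t} (node h u₀ u₁)) ≡ length (frontier u₀) + length (frontier u₁)
length-frontier-node h u₀ u₁ =
  trans (length-++ (map (0 ∷_) (frontier u₀)))
        (cong₂ _+_ (length-map (0 ∷_) (frontier u₀)) (length-map (1 ∷_) (frontier u₁)))

frontier-nonempty : ∀ {t} (u : UFin t) → 1 ≤ length (frontier u)
frontier-nonempty (leaf _)       = s≤s z≤n
frontier-nonempty {t} (node h u₀ u₁) =
  subst (1 ≤_) (sym (length-frontier-node {t} h u₀ u₁))
        (+-mono-≤ (frontier-nonempty u₀) z≤n)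

frontier-length : ∀ {t} (u : UFin t) → t [] ≡ just uni → 2 ≤ length (frontier u)
frontier-length (leaf n)       u = ⊥-elim (n u)
frontier-length {t} (node h u₀ u₁) _ =
  subst (2 ≤_) (sym (length-frontier-node {t} h u₀ u₁))
        (+-mono-≤ (frontier-nonempty u₀) (frontier-nonempty u₁))

frontier-trees : ∀ {t} → IsTree arT t → (u : UFin t) →
  All (λ r → IsTree arT (sub t r)) (frontier u)
frontier-trees T (leaf _)       = T ∷ []
frontier-trees T (node h u₀ u₁) =
  ++⁺ (map⁺ (frontier-trees (IsTree-child T h (s≤s z≤n)) u₀))
      (map⁺ (frontier-trees (IsTree-child T h (s≤s (s≤s z≤n))) u₁))

map-sub-child : ∀ (t : TreeT) i (rs : List Pos) →
  map (sub t) (map (i ∷_) rs) ≡ map (sub (child t i)) rs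
map-sub-child t i []       = refl
map-sub-child t i (r ∷ rs) = cong (sub (child t i) r ∷_) (map-sub-child t i rs)

components-node : ∀ {t} (h : t [] ≡ just uni) (u₀ : UFin (child t 0)) (u₁ : UFin (child t 1)) →
  components {t} (node h u₀ u₁) ≡ components u₀ ++ components u₁
components-node {t} h u₀ u₁ =
  trans (map-++ (sub t) (map (0 ∷_) (frontier u₀)) (map (1 ∷_) (frontier u₁)))
        (cong₂ _++_ (map-sub-child t 0 (frontier u₀)) (map-sub-child t 1 (frontier u₁)))

maxUnion-frontier : ∀ {t} (u : UFin t) → MaxUnion t (components u)
maxUnion-frontier (leaf n)       = single n
maxUnion-frontier {t} (node h u₀ u₁) =
  subst (MaxUnion t) (sym (components-node {t} h u₀ u₁))
        (split h (maxUnion-frontier u₀) (maxUnion-frontier u₁))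

maxUnion-unique : ∀ {t As} → MaxUnion t As → (u : UFin t) → As ≡ components u
maxUnion-unique (single n)      (leaf _)       = refl
maxUnion-unique (single n)      (node h _ _)   = ⊥-elim (n h)
maxUnion-unique (split h _ _)   (leaf n)       = ⊥-elim (n h)
maxUnion-unique {t} (split h m₀ m₁) (node _ u₀ u₁) =
  trans (cong₂ _++_ (maxUnion-unique m₀ u₀) (maxUnion-unique m₁ u₁))
        (sym (components-node {t} h u₀ u₁))

Component : TreeT → Set
Component C = In𝔗 C × ¬ (C [] ≡ just uni)

maxUnion-components : ∀ {t As} → In𝔗 t → MaxUnion t As → All Component As
maxUnion-components ht (single n)      = (ht , n) ∷ []
maxUnion-components ht (split h m₀ m₁) =
  ++⁺ (maxUnion-components (In𝔗-child ht h (s≤s z≤n)) m₀)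
      (maxUnion-components (In𝔗-child ht h (s≤s (s≤s z≤n))) m₁)

maxUnion-component : ∀ {t As} → In𝔗 t → MaxUnion t As →
  (a : Fin (length As)) → Component (lookup As a)
maxUnion-component ht m a = All.lookup (maxUnion-components ht m) (∈-lookup a)

only-component : ∀ {t As} → ¬ (t [] ≡ just uni) → MaxUnion t As →
  (a : Fin (length As)) → lookup As a ≡ t
only-component n (single _)    fzero = refl
only-component n (split h _ _) _     = ⊥-elim (n h)

plain-not-union : ∀ {A B As Bs} → ¬ (A [] ≡ just uni) → ¬ (B [] ≡ just uni) →
  MaxUnion A As → MaxUnion B Bs → ¬ (2 < length As + length Bs)
plain-not-union _  _  (single _)    (single _)    (s≤s (s≤s ()))
plain-not-union nA _  (split h _ _) _             _ = nA h
plain-not-union _  nB (single _)    (split h _ _) _ = nB h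

width : ∀ {t} → UFin t → ℕ
width u = length (frontier u)

rootLabel : Maybe LabT → ℕ → Maybe LabN
rootLabel nothing         _ = nothing
rootLabel (just (atom a)) _ = just (atom a)
rootLabel (just app)      _ = just app
rootLabel (just arr)      _ = just arr
rootLabel (just uni)      n = just (uni (n ∸ 2))

origin : LabN → LabT
origin (atom a) = atom a
origin app      = app
origin arr      = arr
origin (uni _)  = uni

rootLabel-origin : ∀ x n {l} → rootLabel x n ≡ just l → x ≡ just (origin l)
rootLabel-origin (just (atom a)) n refl = refl
rootLabel-origin (just app)      n refl = refl
rootLabel-origin (just arr)      n refl = refl
rootLabel-origin (just uni)      n refl = refl

rootLabel-defined : ∀ l n → ∃ λ l′ → rootLabel (just l) n ≡ just l′
rootLabel-defined (atom a) n = atom a , refl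
rootLabel-defined app      n = app , refl
rootLabel-defined arr      n = arr , refl
rootLabel-defined uni      n = uni (n ∸ 2) , refl

N-root : ∀ t (w : Fin⊕ t) → N t w [] ≡ rootLabel (t []) (width (w []))
N-root t w with t []
... | nothing       = refl
... | just (atom a) = refl
... | just app      = refl
... | just arr      = refl
... | just uni      = refl

N-root-at : ∀ t (w : Fin⊕ t) {x} → t [] ≡ x → N t w [] ≡ rootLabel x (width (w []))
N-root-at t w e = trans (N-root t w) (cong (λ x → rootLabel x (width (w []))) e)

N-origin : ∀ t (w : Fin⊕ t) {l} → N t w [] ≡ just l → t [] ≡ just (origin l)
N-origin t w h = rootLabel-origin (t []) (width (w [])) (trans (sym (N-root t w)) h)

N-root-defined : ∀ t (w : Fin⊕ t) → (∃ λ l → t [] ≡ just l) → ∃ λ l′ → N t w [] ≡ just l′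
N-root-defined t w (l , e) =
  let (l′ , e′) = rootLabel-defined l (width (w [])) in l′ , trans (N-root-at t w e) e′

uni-arity : ∀ t (w : Fin⊕ t) {k} → t [] ≡ just uni → N t w [] ≡ just (uni k) →
  suc (suc k) ≡ width (w [])
uni-arity t w u h =
  trans (cong (2 +_) (uni-injective (just-injective (trans (sym h) (N-root-at t w u)))))
        (m+[n∸m]≡n (frontier-length (w []) u))
  where
    uni-injective : ∀ {m n} → LabN.uni m ≡ uni n → m ≡ n
    uni-injective refl = refl

N-child-binary : ∀ {l} → Binary l → ∀ t (w : Fin⊕ t) i q → t [] ≡ just l →
  N t w (i ∷ q) ≡ N (child t i) (child-Fin⊕ t w i) q
N-child-binary app t w i q h with t [] | h
... | _ | refl = refl
N-child-binary arr t w i q h with t [] | h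
... | _ | refl = refl

N-child-uni : ∀ t (w : Fin⊕ t) i q r → t [] ≡ just uni →
  nth (frontier (w [])) i ≡ just r → N t w (i ∷ q) ≡ N (sub t r) (sub-Fin⊕ t w r) q
N-child-uni t w i q r h e with t [] | h
... | _ | refl with nth (frontier (w [])) i | e
... | _ | refl = refl

N-child-uni-beyond : ∀ t (w : Fin⊕ t) i q → t [] ≡ just uni →
  nth (frontier (w [])) i ≡ nothing → N t w (i ∷ q) ≡ nothing
N-child-uni-beyond t w i q h e with t [] | h
... | _ | refl with nth (frontier (w [])) i | e
... | _ | refl = refl

N-child-atom : ∀ t (w : Fin⊕ t) a i q → t [] ≡ just (atom a) → N t w (i ∷ q) ≡ nothing
N-child-atom t w a i q h with t [] | h
... | _ | refl = refl

N-undefined : ∀ t (w : Fin⊕ t) q → t [] ≡ nothing → N t w q ≡ nothing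
N-undefined t w []      h with t [] | h
... | _ | refl = refl
N-undefined t w (i ∷ q) h with t [] | h
... | _ | refl = refl

Present : ∀ t → Fin⊕ t → ℕ → Set
Present t w i = Σ Pos λ r → Σ (Fin⊕ (sub t r)) λ wr →
  IsTree arT (sub t r) × (∀ q → N t w (i ∷ q) ≡ N (sub t r) wr q)

Absent : ∀ t → Fin⊕ t → ℕ → Set
Absent t w i = ∀ q → N t w (i ∷ q) ≡ nothing

child-present : ∀ {t} (w : Fin⊕ t) → IsTree arT t → ∀ {l} → N t w [] ≡ just l →
  ∀ {i} → i < arN l → Present t w i
child-present w T {atom a} h ()
child-present {t} w T {app} h {i} i<2 =
  i ∷ [] , child-Fin⊕ t w i , IsTree-child T (N-origin t w h) i<2 ,
  λ q → N-child-binary app t w i q (N-origin t w h)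
child-present {t} w T {arr} h {i} i<2 =
  i ∷ [] , child-Fin⊕ t w i , IsTree-child T (N-origin t w h) i<2 ,
  λ q → N-child-binary arr t w i q (N-origin t w h)
child-present {t} w T {uni k} h {i} i<ar
  with nth-< (frontier (w [])) i (subst (i <_) (uni-arity t w (N-origin t w h) h) i<ar)
... | r , e = r , sub-Fin⊕ t w r , nth-All (frontier-trees T (w [])) e ,
              λ q → N-child-uni t w i q r (N-origin t w h) e

child-absent : ∀ {t} (w : Fin⊕ t) → IsTree arT t → ∀ {l} → N t w [] ≡ just l →
  ∀ {i} → arN l ≤ i → Absent t w i
child-absent {t} w T {atom a} h {i} _ q = N-child-atom t w a i q (N-origin t w h)
child-absent {t} w T {app} h {i} 2≤i q =
  trans (N-child-binary app t w i q (N-origin t w h))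
        (N-undefined (child t i) (child-Fin⊕ t w i) q
          (child-undef T [] app (N-origin t w h) i 2≤i []))
child-absent {t} w T {arr} h {i} 2≤i q =
  trans (N-child-binary arr t w i q (N-origin t w h))
        (N-undefined (child t i) (child-Fin⊕ t w i) q
          (child-undef T [] arr (N-origin t w h) i 2≤i []))
child-absent {t} w T {uni k} h {i} ar≤i q =
  N-child-uni-beyond t w i q (N-origin t w h)
    (nth-≥ (frontier (w [])) i (subst (_≤ i) (uni-arity t w (N-origin t w h) h) ar≤i))

childOf : ∀ {t} (w : Fin⊕ t) → IsTree arT t → ∀ i → Present t w i ⊎ Absent t w i
childOf {t} w T i with N-root-defined t w (root-def T)
... | l , h with <-≤-connex i (arN l)
...   | inj₁ i<ar = inj₁ (child-present w T h i<ar)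
...   | inj₂ ar≤i = inj₂ (child-absent w T h ar≤i)

-- The two child conditions of IsTree for N t w, by induction on the position;
-- a present child reduces the position to one in a subtree of t.
N-child-def : ∀ {t} (w : Fin⊕ t) → IsTree arT t → ∀ p l → N t w p ≡ just l →
  ∀ i → i < arN l → ∃ λ l′ → N t w (p ++ i ∷ []) ≡ just l′
N-child-def w T [] l h i i<ar with child-present w T h i<ar
... | r , wr , Tr , e =
  let (l′ , e′) = N-root-defined _ wr (root-def Tr) in l′ , trans (e []) e′
N-child-def w T (j ∷ p) l h i i<ar with childOf w T j
... | inj₂ absent = ⊥-elim (nothing≢just (trans (sym (absent p)) h))
... | inj₁ (r , wr , Tr , e) =
  let (l′ , e′) = N-child-def wr Tr p l (trans (sym (e p)) h) i i<ar
  in l′ , trans (e (p ++ i ∷ [])) e′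

N-child-undef : ∀ {t} (w : Fin⊕ t) → IsTree arT t → ∀ p l → N t w p ≡ just l →
  ∀ i → arN l ≤ i → ∀ q → N t w (p ++ i ∷ q) ≡ nothing
N-child-undef w T [] l h i ar≤i q = child-absent w T h ar≤i q
N-child-undef w T (j ∷ p) l h i ar≤i q with childOf w T j
... | inj₂ absent = ⊥-elim (nothing≢just (trans (sym (absent p)) h))
... | inj₁ (r , wr , Tr , e) =
  trans (e (p ++ i ∷ q)) (N-child-undef wr Tr p l (trans (sym (e p)) h) i ar≤i q)

N-isTree : ∀ {t} (w : Fin⊕ t) → IsTree arT t → In𝔗ⁿ (N t w)
N-isTree w T = record
  { root-def    = N-root-defined _ w (root-def T)
  ; child-def   = N-child-def w T
  ; child-undef = N-child-undef w T }

_≐N_ : TreeN → TreeT → Set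
X ≐N A = Σ (Fin⊕ A) λ w → X ≐ N A w

N𝔗-≐N : ∀ {t} (ht : In𝔗 t) → N𝔗 t ht ≐N t
N𝔗-≐N ht = noInf⊕ ht , λ _ → refl

≐N-tree : ∀ {X A} → IsTree arT A → X ≐N A → In𝔗ⁿ X
≐N-tree T (w , e) = IsTree-resp e (N-isTree w T)

≐N-root : ∀ {X A x} (eX : X ≐N A) → A [] ≡ x → X [] ≡ rootLabel x (width (proj₁ eX []))
≐N-root (w , e) h = trans (e []) (N-root-at _ w h)

≐N-origin : ∀ {X A l} → X ≐N A → X [] ≡ just l → A [] ≡ just (origin l)
≐N-origin (w , e) h = N-origin _ w (trans (sym (e [])) h)

≐N-plain : ∀ {X A} → X ≐N A → ¬ (A [] ≡ just uni) → NotU X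
≐N-plain eX nA k h = nA (≐N-origin eX h)

plain-≐N : ∀ {X A} → X ≐N A → NotU X → ¬ (A [] ≡ just uni)
plain-≐N eX nX u = nX _ (≐N-root eX u)

≐N-child : ∀ {X A l} → X ≐N A → Binary l → A [] ≡ just l → ∀ i → child X i ≐N child A i
≐N-child {A = A} (w , e) b h i =
  child-Fin⊕ A w i , λ q → trans (e (i ∷ q)) (N-child-binary b A w i q h)

record UnionTranslation (X : TreeN) (k : ℕ) (As : List TreeT) : Set where
  field
    size    : suc (suc k) ≡ length As
    summand : ∀ i → chF X i ≐N lookup As (cast size i)

  summand′ : ∀ a → chF X (cast (sym size) a) ≐N lookup As a
  summand′ a = subst (λ b → chF X (cast (sym size) a) ≐N lookup As b)
                     (cast-involutive size (sym size) a) (summand (cast (sym size) a))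

open UnionTranslation

union-translation : ∀ {X A As k} → X ≐N A → MaxUnion A As → X [] ≡ just (uni k) →
  UnionTranslation X k As
union-translation {X} {A} {k = k} (w , eX) m hX with maxUnion-unique m (w [])
... | refl = record { size = arity ; summand = summand-at }
  where
    hN : N A w [] ≡ just (uni k)
    hN = trans (sym (eX [])) hX

    u : A [] ≡ just uni
    u = N-origin A w hN

    arity : suc (suc k) ≡ length (components (w []))
    arity = trans (uni-arity A w u hN) (sym (length-map (sub A) (frontier (w []))))

    summand-at : ∀ i → chF X i ≐N lookup (components (w [])) (cast arity i)
    summand-at i with nth-map-lookup (sub A) (frontier (w [])) (cast arity i)
    ... | r , e , el =
      subst (chF X i ≐N_) (sym el)
        (sub-Fin⊕ A w r , λ q → trans (eX _)
          (N-child-uni A w (toℕ i) q r u (trans (cong (nth (frontier (w []))) (sym (toℕ-cast arity i))) e)))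

summands-plain : ∀ {X A As k} → In𝔗 A → MaxUnion A As → (tX : UnionTranslation X k As) →
  ∀ i → NotU (chF X i)
summands-plain hA mA tX i =
  ≐N-plain (summand tX i) (proj₂ (maxUnion-component hA mA (cast (size tX) i)))

size-bound : ∀ {k m} → suc (suc k) ≡ m → 2 ≤ m
size-bound refl = s≤s (s≤s z≤n)

StepT-map : ∀ {S S′ : TreeT → TreeT → Set} {A B} →
  (∀ {x y} → S x y → S′ x y) → StepT S A B → StepT S′ A B
StepT-map φ (atom a h₁ h₂)                     = atom a h₁ h₂
StepT-map φ (app h₁ h₂ s₀ s₁)                  = app h₁ h₂ (φ s₀) (φ s₁)
StepT-map φ (arr h₁ h₂ s₀ s₁)                  = arr h₁ h₂ (φ s₀) (φ s₁)
StepT-map φ (union As Bs mA mB lt f g hf hg) =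
  union As Bs mA mB lt f g (λ i → φ (hf i)) (λ j → φ (hg j))

StepT-flip : ∀ {S S′ : TreeT → TreeT → Set} {A B} →
  (∀ {x y} → S x y → S′ y x) → StepT S A B → StepT S′ B A
StepT-flip φ (atom a h₁ h₂)                     = atom a h₂ h₁
StepT-flip φ (app h₁ h₂ s₀ s₁)                  = app h₂ h₁ (φ s₀) (φ s₁)
StepT-flip φ (arr h₁ h₂ s₀ s₁)                  = arr h₂ h₁ (φ s₀) (φ s₁)
StepT-flip φ (union As Bs mA mB lt f g hf hg) =
  union Bs As mB mA (subst (2 <_) (+-comm (length As) (length Bs)) lt) g f
        (λ j → φ (hg j)) (λ i → φ (hf i))

StepN-map : ∀ {R R′ : TreeN → TreeN → Set} {X Y} →
  (∀ {x y} → R x y → R′ x y) → StepN R X Y → StepN R′ X Y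
StepN-map φ (atom a h₁ h₂)                    = atom a h₁ h₂
StepN-map φ (app h₁ h₂ r₀ r₁)                 = app h₁ h₂ (φ r₀) (φ r₁)
StepN-map φ (arr h₁ h₂ r₀ r₁)                 = arr h₁ h₂ (φ r₀) (φ r₁)
StepN-map φ (uu k l h₁ h₂ n₁ n₂ f g hf hg) = uu k l h₁ h₂ n₁ n₂ f g (λ i → φ (hf i)) (λ j → φ (hg j))
StepN-map φ (ul k h n ns hs)                  = ul k h n ns (λ i → φ (hs i))
StepN-map φ (ur l h n ns hs)                  = ur l h n ns (λ j → φ (hs j))

StepN-flip : ∀ {R R′ : TreeN → TreeN → Set} {X Y} →
  (∀ {x y} → R x y → R′ y x) → StepN R X Y → StepN R′ Y X
StepN-flip φ (atom a h₁ h₂)                    = atom a h₂ h₁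
StepN-flip φ (app h₁ h₂ r₀ r₁)                 = app h₂ h₁ (φ r₀) (φ r₁)
StepN-flip φ (arr h₁ h₂ r₀ r₁)                 = arr h₂ h₁ (φ r₀) (φ r₁)
StepN-flip φ (uu k l h₁ h₂ n₁ n₂ f g hf hg) = uu l k h₂ h₁ n₂ n₁ g f (λ j → φ (hg j)) (λ i → φ (hf i))
StepN-flip φ (ul k h n ns hs)                  = ur k h n ns (λ i → φ (hs i))
StepN-flip φ (ur l h n ns hs)                  = ul l h n ns (λ j → φ (hs j))

symClosure-simT : ∀ {S} → IsSimT S → IsSimT (SymClosure S)
symClosure-simT simS A B (fwd s) = let (hA , hB , st) = simS A B s in hA , hB , StepT-map fwd st
symClosure-simT simS A B (bwd s) = let (hB , hA , st) = simS B A s in hA , hB , StepT-flip bwd st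

symClosure-simN : ∀ {R} → IsSimN R → IsSimN (SymClosure R)
symClosure-simN simR X Y (fwd r) = let (tX , tY , st) = simR X Y r in tX , tY , StepN-map fwd st
symClosure-simN simR X Y (bwd r) = let (tY , tX , st) = simR Y X r in tX , tY , StepN-flip bwd st

Image : (TreeT → TreeT → Set) → TreeN → TreeN → Set
Image S X Y = Σ TreeT λ A → Σ TreeT λ B → S A B × X ≐N A × Y ≐N B

module Forward {S : TreeT → TreeT → Set} (simS : IsSimT S) (symS : Symmetric S) where

  image-sym : Symmetric (Image S)
  image-sym (A , B , s , eX , eY) = B , A , symS s , eY , eX

  union-union : ∀ {A B X Y As Bs} → In𝔗 A → In𝔗 B → X ≐N A → Y ≐N B →
    A [] ≡ just uni → B [] ≡ just uni → MaxUnion A As → MaxUnion B Bs →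
    (f : Fin (length As) → Fin (length Bs)) (g : Fin (length Bs) → Fin (length As)) →
    (∀ a → S (lookup As a) (lookup Bs (f a))) → (∀ b → S (lookup As (g b)) (lookup Bs b)) →
    StepN (Image S) X Y
  union-union hA hB eX eY uA uB mA mB f g hf hg =
    uu _ _ (≐N-root eX uA) (≐N-root eY uB) (summands-plain hA mA tX) (summands-plain hB mB tY)
       (λ i → cast (sym (size tY)) (f (cast (size tX) i)))
       (λ j → cast (sym (size tX)) (g (cast (size tY) j)))
       (λ i → _ , _ , hf (cast (size tX) i) , summand tX i , summand′ tY (f (cast (size tX) i)))
       (λ j → _ , _ , hg (cast (size tY) j) , summand′ tX (g (cast (size tY) j)) , summand tY j)
    where
      tX = union-translation eX mA (≐N-root eX uA)
      tY = union-translation eY mB (≐N-root eY uB)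

  union-plain : ∀ {A B X Y As} → In𝔗 A → X ≐N A → Y ≐N B →
    A [] ≡ just uni → ¬ (B [] ≡ just uni) → MaxUnion A As →
    (∀ a → S (lookup As a) B) → StepN (Image S) X Y
  union-plain hA eX eY uA nB mA hf =
    ul _ (≐N-root eX uA) (≐N-plain eY nB) (summands-plain hA mA tX)
       (λ i → _ , _ , hf (cast (size tX) i) , summand tX i , eY)
    where
      tX = union-translation eX mA (≐N-root eX uA)

  -- Each ≃𝔗 rule concluding A ≃ B yields a ≃∅ rule concluding N A ≃ N B;
  -- for ⊃ the symmetry of S supplies the swapped first premise.
  step : ∀ {A B X Y} → In𝔗 A → In𝔗 B → X ≐N A → Y ≐N B → StepT S A B → StepN (Image S) X Y
  step hA hB eX eY (atom a h₁ h₂) = atom a (≐N-root eX h₁) (≐N-root eY h₂)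
  step hA hB eX eY (app h₁ h₂ s₀ s₁) = app (≐N-root eX h₁) (≐N-root eY h₂)
    (_ , _ , s₀ , ≐N-child eX app h₁ 0 , ≐N-child eY app h₂ 0)
    (_ , _ , s₁ , ≐N-child eX app h₁ 1 , ≐N-child eY app h₂ 1)
  step hA hB eX eY (arr h₁ h₂ s₀ s₁) = arr (≐N-root eX h₁) (≐N-root eY h₂)
    (_ , _ , symS s₀ , ≐N-child eY arr h₂ 0 , ≐N-child eX arr h₁ 0)
    (_ , _ , s₁ , ≐N-child eX arr h₁ 1 , ≐N-child eY arr h₂ 1)
  step {A} {B} hA hB eX eY (union As Bs mA mB lt f g hf hg) with isUni (A []) | isUni (B [])
  ... | inj₁ uA | inj₁ uB = union-union hA hB eX eY uA uB mA mB f g hf hg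
  ... | inj₁ uA | inj₂ nB =
    union-plain hA eX eY uA nB mA (λ a → subst (S _) (only-component nB mB (f a)) (hf a))
  ... | inj₂ nA | inj₁ uB = StepN-flip image-sym
    (union-plain hB eY eX uB nA mB
      (λ b → symS (subst (λ C → S C _) (only-component nA mA (g b)) (hg b))))
  ... | inj₂ nA | inj₂ nB = ⊥-elim (plain-not-union nA nB mA mB lt)

  image-simN : IsSimN (Image S)
  image-simN X Y (A , B , s , eX , eY) =
    let (hA , hB , st) = simS A B s
    in ≐N-tree (isTree hA) eX , ≐N-tree (isTree hB) eY , step hA hB eX eY st

Preimage : (TreeN → TreeN → Set) → TreeT → TreeT → Set
Preimage R A B = In𝔗 A × In𝔗 B × Σ TreeN λ X → Σ TreeN λ Y → R X Y × X ≐N A × Y ≐N B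

module Backward {R : TreeN → TreeN → Set} (simR : IsSimN R) (symR : Symmetric R) where

  preimage-sym : Symmetric (Preimage R)
  preimage-sym (hA , hB , X , Y , r , eX , eY) = hB , hA , Y , X , symR r , eY , eX

  related-children : ∀ {A B X Y l i} → Binary l → In𝔗 A → In𝔗 B → X ≐N A → Y ≐N B →
    A [] ≡ just l → B [] ≡ just l → i < 2 → R (child X i) (child Y i) →
    Preimage R (child A i) (child B i)
  related-children b hA hB eX eY h₁ h₂ i<2 r =
    In𝔗-binary-child b hA h₁ i<2 , In𝔗-binary-child b hB h₂ i<2 , _ , _ , r ,
    ≐N-child eX b h₁ _ , ≐N-child eY b h₂ _

  union-union : ∀ {A B X Y k l} → In𝔗 A → In𝔗 B → X ≐N A → Y ≐N B →
    X [] ≡ just (uni k) → Y [] ≡ just (uni l) →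
    (f : Fin (suc (suc k)) → Fin (suc (suc l))) (g : Fin (suc (suc l)) → Fin (suc (suc k))) →
    (∀ i → R (chF X i) (chF Y (f i))) → (∀ j → R (chF X (g j)) (chF Y j)) →
    StepT (Preimage R) A B
  union-union hA hB eX eY hX hY f g hf hg =
    union _ _ mA mB (+-mono-≤-< (size-bound (size tX)) (≤-trans (s≤s z≤n) (size-bound (size tY))))
      (λ a → cast (size tY) (f (cast (sym (size tX)) a)))
      (λ b → cast (size tX) (g (cast (sym (size tY)) b)))
      (λ a → component hA mA a , component hB mB _ , _ , _ ,
             hf (cast (sym (size tX)) a) , summand′ tX a , summand tY (f (cast (sym (size tX)) a)))
      (λ b → component hA mA _ , component hB mB b , _ , _ ,
             hg (cast (sym (size tY)) b) , summand tX (g (cast (sym (size tY)) b)) , summand′ tY b)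
    where
      mA = maxUnion-frontier (proj₁ eX [])
      mB = maxUnion-frontier (proj₁ eY [])
      tX = union-translation eX mA hX
      tY = union-translation eY mB hY
      component : ∀ {t As} → In𝔗 t → MaxUnion t As → (a : Fin (length As)) → In𝔗 (lookup As a)
      component ht m a = proj₁ (maxUnion-component ht m a)

  union-plain : ∀ {A B X Y k} → In𝔗 A → In𝔗 B → X ≐N A → Y ≐N B →
    X [] ≡ just (uni k) → NotU Y → (∀ i → R (chF X i) Y) → StepT (Preimage R) A B
  union-plain {B = B} hA hB eX eY hX nY hr =
    union _ (B ∷ []) mA (single (plain-≐N eY nY)) (+-mono-≤-< (size-bound (size tX)) (s≤s z≤n))
      (λ _ → fzero) (λ _ → cast (size tX) fzero)
      (λ a → component a , hB , _ , _ , hr (cast (sym (size tX)) a) , summand′ tX a , eY)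
      (λ { fzero → component _ , hB , _ , _ , hr fzero , summand tX fzero , eY })
    where
      mA = maxUnion-frontier (proj₁ eX [])
      tX = union-translation eX mA hX
      component : ∀ a → In𝔗 (lookup (components (proj₁ eX [])) a)
      component a = proj₁ (maxUnion-component hA mA a)

  step : ∀ {A B X Y} → In𝔗 A → In𝔗 B → X ≐N A → Y ≐N B → StepN R X Y → StepT (Preimage R) A B
  step hA hB eX eY (atom a h₁ h₂) = atom a (≐N-origin eX h₁) (≐N-origin eY h₂)
  step hA hB eX eY (app h₁ h₂ r₀ r₁) = app uA uB
    (related-children app hA hB eX eY uA uB (s≤s z≤n) r₀)
    (related-children app hA hB eX eY uA uB (s≤s (s≤s z≤n)) r₁)
    where
      uA = ≐N-origin eX h₁
      uB = ≐N-origin eY h₂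
  step hA hB eX eY (arr h₁ h₂ r₀ r₁) = arr uA uB
    (related-children arr hA hB eX eY uA uB (s≤s z≤n) (symR r₀))
    (related-children arr hA hB eX eY uA uB (s≤s (s≤s z≤n)) r₁)
    where
      uA = ≐N-origin eX h₁
      uB = ≐N-origin eY h₂
  step hA hB eX eY (uu k l h₁ h₂ _ _ f g hf hg) = union-union hA hB eX eY h₁ h₂ f g hf hg
  step hA hB eX eY (ul k h₁ nY _ hr) = union-plain hA hB eX eY h₁ nY hr
  step hA hB eX eY (ur l h₂ nX _ hr) =
    StepT-flip preimage-sym (union-plain hB hA eY eX h₂ nX (λ j → symR (hr j)))

  preimage-simT : IsSimT (Preimage R)
  preimage-simT A B (hA , hB , X , Y , r , eX , eY) =
    hA , hB , step hA hB eX eY (proj₂ (proj₂ (simR X Y r)))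

proposition14 : (A B : TreeT) (hA : In𝔗 A) (hB : In𝔗 B) →
    (A ≃𝔗 B) ⇔ (N𝔗 A hA ≃∅ N𝔗 B hB)
proposition14 A B hA hB = mk⇔ to from
  where
    to : A ≃𝔗 B → N𝔗 A hA ≃∅ N𝔗 B hB
    to (S , simS , s) =
      Image (SymClosure S) , Forward.image-simN (symClosure-simT simS) (symmetric S) ,
      A , B , fwd s , N𝔗-≐N hA , N𝔗-≐N hB

    from : N𝔗 A hA ≃∅ N𝔗 B hB → A ≃𝔗 B
    from (R , simR , r) =
      Preimage (SymClosure R) , Backward.preimage-simT (symClosure-simN simR) (symmetric R) ,
      hA , hB , _ , _ , fwd r , N𝔗-≐N hA , N𝔗-≐N hB
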